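{- Let $S$ be a set with a tolerance relation $T$, let $\mathcal{T}=\{\bigcap\Gamma:\Gamma\subseteq\mathcal{B}\}$ where $\mathcal{B}$ is the set of blocks of $T$, and let $\delta(S)=\{\bigcup H: H\subseteq\mathcal{T}\}$. In general, neither $\mathcal{T}$ nor $\delta(S)$ is closed under the operation $A\cdot B=A^c\cup B$; that is, there exist such $S,T$ and $A,B\in\mathcal{T}$ with $A^c\cup B\notin\mathcal{T}$, and there exist such $S,T$ and $A,B\in\delta(S)$ with $A^c\cup B\notin\delta(S)$.
   Context: A tolerance on $S$ is a reflexive symmetric binary relation. A block of $T$ is a maximal subset $B\subseteq S$ with $B\times B\subseteq T$. Elements of $\mathcal{T}$ are called squeezed blocks, and $\delta(S)$ is the set of definable objects. -}

module Defs where

open import Level using (Level; 0ℓ) renaming (suc to lsuc)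
open import Data.Product using (Σ; _×_; _,_; ∃)
open import Data.Sum using (_⊎_)
open import Relation.Nullary using (¬_)
open import Relation.Binary using (Rel; Reflexive; Symmetric)

Subset : Set → Set₁
Subset S = S → Set

Family : Set → Set₂
Family S = Subset S → Set₁

-- Inclusion / extensional equality, allowed between predicates of
-- different universe levels (needed since ⋂ and ⋃ of families land higher).
_⊆_ : {a b : Level} {S : Set} → (S → Set a) → (S → Set b) → Set (a Level.⊔ b)
A ⊆ B = ∀ x → A x → B x

_≐_ : {a b : Level} {S : Set} → (S → Set a) → (S → Set b) → Set (a Level.⊔ b)
A ≐ B = A ⊆ B × B ⊆ A

record IsTolerance {S : Set} (T : Rel S 0ℓ) : Set where
  field
    refl : Reflexive T
    sym  : Symmetric T

Square⊆ : {S : Set} → Rel S 0ℓ → Subset S → Set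
Square⊆ T B = ∀ x y → B x → B y → T x y

IsBlock : {S : Set} → Rel S 0ℓ → Subset S → Set₁
IsBlock {S} T B = Square⊆ T B × (∀ (C : Subset S) → B ⊆ C → Square⊆ T C → C ⊆ B)

-- Intersection of a family (empty family gives all of S).
⋂ : {S : Set} → Family S → S → Set₁
⋂ Γ x = ∀ B → Γ B → B x

⋃ : {S : Set} → (Subset S → Set₂) → S → Set₂
⋃ H x = Σ (Subset _) λ B → H B × B x

InSqueezed : {S : Set} → Rel S 0ℓ → Subset S → Set₂
InSqueezed {S} T A =
  Σ (Family S) λ Γ → (∀ B → Γ B → IsBlock T B) × (A ≐ ⋂ Γ)

InDefinable : {S : Set} → Rel S 0ℓ → Subset S → Set₃
InDefinable {S} T A =
  Σ (Subset S → Set₂) λ H →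
    (∀ B → H B → InSqueezed T B) × (A ≐ ⋃ H)

_·_ : {S : Set} → Subset S → Subset S → Subset S
(A · B) x = ¬ A x ⊎ B x

-- For the discrete tolerance on {a, b, c} the blocks are the singletons, so a
-- squeezed set is ∅, a singleton or everything; {a} · ∅ = {b, c} is none of
-- these. For the path tolerance a ~ b ~ c the middle point b is tolerant to
-- every point, so it lies in every block, hence in every squeezed set, hence in
-- every nonempty definable set; but {b} · ∅ = {a, c} is nonempty and misses b.
module Submission where

open import Defs
import Level
open import Level using (0ℓ; Lift; lift)
open import Data.Product using (Σ; _×_; _,_; proj₁; proj₂)
open import Data.Sum using (_⊎_; inj₁; inj₂)
open import Data.Empty using (⊥; ⊥-elim)
open import Data.Unit using (⊤; tt)
open import Relation.Nullary using (¬_)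
open import Relation.Binary using (Rel)
open import Relation.Binary.PropositionalEquality using (_≡_; refl; sym; trans)
open import Relation.Unary using (∅; ｛_｝; _∪_; _∩_)

module _ {S : Set} {T : Rel S 0ℓ} where

  pair-inSqueezed : ∀ {A B₁ B₂} → IsBlock T B₁ → IsBlock T B₂ →
                    A ≐ (B₁ ∩ B₂) → InSqueezed T A
  pair-inSqueezed {A} {B₁} {B₂} block₁ block₂ (A⊆ , ⊆A) =
    Γ , Γ-blocks , A⊆⋂Γ , ⋂Γ⊆A
    where
    Γ : Family S
    Γ B = Lift (Level.suc 0ℓ) (B ≡ B₁ ⊎ B ≡ B₂)

    Γ-blocks : ∀ B → Γ B → IsBlock T B
    Γ-blocks _ (lift (inj₁ refl)) = block₁
    Γ-blocks _ (lift (inj₂ refl)) = block₂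

    A⊆⋂Γ : A ⊆ ⋂ Γ
    A⊆⋂Γ x Ax _ (lift (inj₁ refl)) = proj₁ (A⊆ x Ax)
    A⊆⋂Γ x Ax _ (lift (inj₂ refl)) = proj₂ (A⊆ x Ax)

    ⋂Γ⊆A : ⋂ Γ ⊆ A
    ⋂Γ⊆A x ⋂Γx = ⊆A x (⋂Γx B₁ (lift (inj₁ refl)) , ⋂Γx B₂ (lift (inj₂ refl)))

  block-inSqueezed : ∀ {B} → IsBlock T B → InSqueezed T B
  block-inSqueezed block =
    pair-inSqueezed block block ((λ _ Bx → Bx , Bx) , λ _ → proj₁)

  inSqueezed⇒inDefinable : ∀ {A} → InSqueezed T A → InDefinable T A
  inSqueezed⇒inDefinable {A} squeezed =
    H , (λ { _ (lift refl) → squeezed }) ,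
    (λ _ Ax → A , lift refl , Ax) , (λ { _ (_ , lift refl , Ax) → Ax })
    where
    H : Subset S → Set₂
    H X = Lift _ (X ≡ A)

  ∅-inDefinable : InDefinable T ∅
  ∅-inDefinable = (λ _ → Lift _ ⊥) , (λ _ ()) , (λ _ ()) , (λ { _ (_ , () , _) })

  -- No block contains the intolerant pair, so the family of blocks is empty.
  inSqueezed-intolerant⇒full : ∀ {A x y} → InSqueezed T A → A x → A y → ¬ T x y →
                               ∀ z → A z
  inSqueezed-intolerant⇒full (Γ , Γ-blocks , A⊆⋂Γ , ⋂Γ⊆A) Ax Ay ¬Txy z =
    ⋂Γ⊆A z λ B ΓB → ⊥-elim
      (¬Txy (proj₁ (Γ-blocks B ΓB) _ _ (A⊆⋂Γ _ Ax B ΓB) (A⊆⋂Γ _ Ay B ΓB)))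

  module _ (tolerance : IsTolerance T) {y : S} (y-tolerant : ∀ z → T y z) where

    tolerant-to-all⇒∈-block : ∀ {B} → IsBlock T B → B y
    tolerant-to-all⇒∈-block {B} (square , maximal) =
      maximal (B ∪ ｛ y ｝) (λ _ → inj₁) square∪ y (inj₂ refl)
      where
      square∪ : Square⊆ T (B ∪ ｛ y ｝)
      square∪ x z (inj₁ Bx) (inj₁ Bz)   = square x z Bx Bz
      square∪ x _ (inj₁ _)  (inj₂ refl) = IsTolerance.sym tolerance (y-tolerant x)
      square∪ _ z (inj₂ refl) _         = y-tolerant z

    tolerant-to-all⇒∈-squeezed : ∀ {A} → InSqueezed T A → A y
    tolerant-to-all⇒∈-squeezed (Γ , Γ-blocks , _ , ⋂Γ⊆A) =
      ⋂Γ⊆A y λ B ΓB → tolerant-to-all⇒∈-block (Γ-blocks B ΓB)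

    tolerant-to-all⇒∈-inhabited-definable : ∀ {A x} → InDefinable T A → A x → A y
    tolerant-to-all⇒∈-inhabited-definable (H , H-squeezed , A⊆⋃H , ⋃H⊆A) Ax
      with A⊆⋃H _ Ax
    ... | X , HX , _ = ⋃H⊆A y (X , HX , tolerant-to-all⇒∈-squeezed (H-squeezed X HX))

≡-isTolerance : {S : Set} → IsTolerance {S} _≡_
≡-isTolerance = record { refl = refl ; sym = sym }

｛｝-isBlock-≡ : {S : Set} (t : S) → IsBlock _≡_ ｛ t ｝
｛｝-isBlock-≡ t = (λ _ _ t≡x t≡y → trans (sym t≡x) t≡y) ,
                  (λ C ｛t｝⊆C square x Cx → square t x (｛t｝⊆C t refl) Cx)

·∅-∌ : {S : Set} {A : Subset S} {x : S} → A x → ¬ (A · ∅) x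
·∅-∌ Ax (inj₁ ¬Ax) = ¬Ax Ax

data Three : Set where
  a b c : Three

squeezed-not-closed : Σ Set λ S → Σ (Rel S 0ℓ) λ T → IsTolerance T ×
  Σ (Subset S) λ A → Σ (Subset S) λ B →
    InSqueezed T A × InSqueezed T B × ¬ InSqueezed T (A · B)
squeezed-not-closed =
  Three , _≡_ , ≡-isTolerance , ｛ a ｝ , ∅ ,
  block-inSqueezed (｛｝-isBlock-≡ a) , ∅-inSqueezed , ¬｛a｝·∅-inSqueezed
  where
  ∅-inSqueezed : InSqueezed _≡_ ∅
  ∅-inSqueezed = pair-inSqueezed (｛｝-isBlock-≡ a) (｛｝-isBlock-≡ b)
    ((λ _ ()) , λ { _ (refl , ()) })

  ¬｛a｝·∅-inSqueezed : ¬ InSqueezed _≡_ (｛ a ｝ · ∅)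
  ¬｛a｝·∅-inSqueezed squeezed = ·∅-∌ {A = ｛ a ｝} refl
    (inSqueezed-intolerant⇒full {x = b} {y = c} squeezed
      (inj₁ λ ()) (inj₁ λ ()) (λ ()) a)

_~_ : Rel Three 0ℓ
a ~ c = ⊥
c ~ a = ⊥
_ ~ _ = ⊤

~-isTolerance : IsTolerance _~_
~-isTolerance = record { refl = λ { {a} → tt ; {b} → tt ; {c} → tt } ; sym = ~-sym }
  where
  ~-sym : ∀ {x y} → x ~ y → y ~ x
  ~-sym {a} {a} _ = tt
  ~-sym {a} {b} _ = tt
  ~-sym {b} {a} _ = tt
  ~-sym {b} {b} _ = tt
  ~-sym {b} {c} _ = tt
  ~-sym {c} {b} _ = tt
  ~-sym {c} {c} _ = tt

ab bc : Subset Three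
ab c = ⊥
ab _ = ⊤
bc a = ⊥
bc _ = ⊤

ab-isBlock : IsBlock _~_ ab
ab-isBlock = square , maximal
  where
  square : Square⊆ _~_ ab
  square a a _ _ = tt
  square a b _ _ = tt
  square b a _ _ = tt
  square b b _ _ = tt
  maximal : ∀ C → ab ⊆ C → Square⊆ _~_ C → C ⊆ ab
  maximal C ab⊆C square a _  = tt
  maximal C ab⊆C square b _  = tt
  maximal C ab⊆C square c Cc = square a c (ab⊆C a tt) Cc

bc-isBlock : IsBlock _~_ bc
bc-isBlock = square , maximal
  where
  square : Square⊆ _~_ bc
  square b b _ _ = tt
  square b c _ _ = tt
  square c b _ _ = tt
  square c c _ _ = tt
  maximal : ∀ C → bc ⊆ C → Square⊆ _~_ C → C ⊆ bc
  maximal C bc⊆C square a Ca = square a c Ca (bc⊆C c tt)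
  maximal C bc⊆C square b _  = tt
  maximal C bc⊆C square c _  = tt

definable-not-closed : Σ Set λ S → Σ (Rel S 0ℓ) λ T → IsTolerance T ×
  Σ (Subset S) λ A → Σ (Subset S) λ B →
    InDefinable T A × InDefinable T B × ¬ InDefinable T (A · B)
definable-not-closed =
  Three , _~_ , ~-isTolerance , ｛ b ｝ , ∅ ,
  inSqueezed⇒inDefinable ｛b｝-inSqueezed , ∅-inDefinable , ¬｛b｝·∅-inDefinable
  where
  ｛b｝≐ab∩bc : ｛ b ｝ ≐ (ab ∩ bc)
  ｛b｝≐ab∩bc = (λ { _ refl → tt , tt })
             , (λ { a (_ , ()) ; b _ → refl ; c (() , _) })

  ｛b｝-inSqueezed : InSqueezed _~_ ｛ b ｝
  ｛b｝-inSqueezed = pair-inSqueezed ab-isBlock bc-isBlock ｛b｝≐ab∩bc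

  ¬｛b｝·∅-inDefinable : ¬ InDefinable _~_ (｛ b ｝ · ∅)
  ¬｛b｝·∅-inDefinable definable = ·∅-∌ {A = ｛ b ｝} refl
    (tolerant-to-all⇒∈-inhabited-definable ~-isTolerance {y = b} (λ _ → tt)
      {x = a} definable (inj₁ λ ()))

mainTheorem3 :
    (Σ Set λ S → Σ (Rel S 0ℓ) λ T → IsTolerance T ×
      Σ (Subset S) λ A → Σ (Subset S) λ B →
        InSqueezed T A × InSqueezed T B × ¬ InSqueezed T (A · B))
    ×
    (Σ Set λ S → Σ (Rel S 0ℓ) λ T → IsTolerance T ×
      Σ (Subset S) λ A → Σ (Subset S) λ B →
        InDefinable T A × InDefinable T B × ¬ InDefinable T (A · B))
mainTheorem3 = squeezed-not-closed , definable-not-closed
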